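{- Let $A, A' : \mathsf{Set}$, $A_R : A \to A' \to \mathsf{Prop}$, $B : A \to \mathsf{Set}$, $B' : A' \to \mathsf{Set}$, and $B_R : \forall (a:A)(a':A'),\ A_R\,a\,a' \to B\,a \to B'\,a' \to \mathsf{Prop}$. Define $R_\Pi : (\forall a:A,\ B\,a) \to (\forall a':A',\ B'\,a') \to \mathsf{Prop}$ by $R_\Pi\,f\,f' := \forall (a:A)(a':A')(a_R : A_R\,a\,a'),\ B_R\,a\,a'\,a_R\,(f\,a)\,(f'\,a')$. If $\mathrm{Total}(A_R)$, for all $a, a', a_R : A_R\,a\,a'$ $\mathrm{Total}(B_R\,a\,a'\,a_R)$, and $\mathrm{OneToOne}(A_R)$, then $\mathrm{Total}(R_\Pi)$.
   Context: Coq's type theory (CIC) with universes $\mathsf{Prop}$, $\mathsf{Set}$, assuming the proof irrelevance axiom ($\forall P:\mathsf{Prop},\ \forall p\,q:P,\ p = q$). $\{x:T \,\&\, P\,x\}$ is a Σ type, $\times$ a product. For $X,Y:\mathsf{Set}$ and $R : X\to Y\to\mathsf{Prop}$: $\mathrm{Total}(R) := (\forall x,\{y \,\&\, R\,x\,y\}) \times (\forall y,\{x \,\&\, R\,x\,y\})$; $\mathrm{OneToOne}(R) := (\forall x\,y_1\,y_2,\ R\,x\,y_1 \to R\,x\,y_2 \to y_1 = y_2) \wedge (\forall y\,x_1\,x_2,\ R\,x_1\,y \to R\,x_2\,y \to x_1 = x_2)$. -}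

module Defs where

open import Data.Product using (Σ; _×_)
open import Relation.Binary.PropositionalEquality using (_≡_)

-- Coq's Prop is modelled by Set; the proof-irrelevance axiom is supplied
-- as an explicit hypothesis for the relevant Prop-valued families.

IsProp : Set → Set
IsProp P = (p q : P) → p ≡ q

Total : {X Y : Set} → (X → Y → Set) → Set
Total {X} {Y} R = ((x : X) → Σ Y (λ y → R x y)) × ((y : Y) → Σ X (λ x → R x y))

OneToOne : {X Y : Set} → (X → Y → Set) → Set
OneToOne {X} {Y} R =
  ((x : X) (y₁ y₂ : Y) → R x y₁ → R x y₂ → y₁ ≡ y₂) ×
  ((y : Y) (x₁ x₂ : X) → R x₁ y → R x₂ y → x₁ ≡ x₂)

RΠ : {A A' : Set} (AR : A → A' → Set) {B : A → Set} {B' : A' → Set}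
     (BR : (a : A) (a' : A') → AR a a' → B a → B' a' → Set) →
     ((a : A) → B a) → ((a' : A') → B' a') → Set
RΠ {A} {A'} AR BR f f' = (a : A) (a' : A') (aR : AR a a') → BR a a' aR (f a) (f' a')

module Submission where

open import Defs
open import Data.Product using (Σ; _,_; proj₁; proj₂)
open import Function using (flip)
open import Relation.Binary.PropositionalEquality using (_≡_; refl)

-- To relate f to some f', send a' to a chosen partner of f a, where a is a
-- chosen preimage of a'.  Any other pair a R a' forces the same a by
-- uniqueness of preimages, and the same proof of a R a' by proof
-- irrelevance, so the chosen relation proof serves for it too.  The other
-- direction is the same construction applied to the flipped relations.

module _ {A A' : Set} (AR : A → A' → Set) {B : A → Set} {B' : A' → Set}
         (BR : (a : A) (a' : A') → AR a a' → B a → B' a' → Set) where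

  BR-unique-source : ((a : A) (a' : A') → IsProp (AR a a')) →
                     ((a' : A') (a₁ a₂ : A) → AR a₁ a' → AR a₂ a' → a₁ ≡ a₂) →
                     (f : (a : A) → B a) {a₀ a : A} {a' : A'} {b' : B' a'}
                     (aR₀ : AR a₀ a') (aR : AR a a') →
                     BR a₀ a' aR₀ (f a₀) b' → BR a a' aR (f a) b'
  BR-unique-source irrA injA f {a₀} {a} {a'} aR₀ aR r
    with injA a' a a₀ aR aR₀
  ... | refl with irrA a a' aR aR₀
  ... | refl = r

  RΠ-leftTotal : ((a : A) (a' : A') → IsProp (AR a a')) →
                 ((a' : A') (a₁ a₂ : A) → AR a₁ a' → AR a₂ a' → a₁ ≡ a₂) →
                 ((a' : A') → Σ A (λ a → AR a a')) →
                 ((a : A) (a' : A') (aR : AR a a') (b : B a) → Σ (B' a') (BR a a' aR b)) →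
                 (f : (a : A) → B a) → Σ ((a' : A') → B' a') (RΠ AR BR f)
  RΠ-leftTotal irrA injA preimage partner f = f' , related
    where
    partnerAt : (a' : A') → Σ (B' a') (BR _ a' (proj₂ (preimage a')) (f (proj₁ (preimage a'))))
    partnerAt a' = partner _ a' (proj₂ (preimage a')) (f (proj₁ (preimage a')))

    f' : (a' : A') → B' a'
    f' a' = proj₁ (partnerAt a')

    related : RΠ AR BR f f'
    related a a' aR =
      BR-unique-source irrA injA f (proj₂ (preimage a')) aR (proj₂ (partnerAt a'))

RΠ-rightTotal : {A A' : Set} (AR : A → A' → Set) {B : A → Set} {B' : A' → Set}
                (BR : (a : A) (a' : A') → AR a a' → B a → B' a' → Set) →
                ((a : A) (a' : A') → IsProp (AR a a')) →
                ((a : A) (a₁' a₂' : A') → AR a a₁' → AR a a₂' → a₁' ≡ a₂') →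
                ((a : A) → Σ A' (AR a)) →
                ((a : A) (a' : A') (aR : AR a a') (b' : B' a') → Σ (B a) (λ b → BR a a' aR b b')) →
                (f' : (a' : A') → B' a') → Σ ((a : A) → B a) (λ f → RΠ AR BR f f')
RΠ-rightTotal AR BR irrA injA' image partner f' =
  let f , related = RΠ-leftTotal (flip AR) (λ a' a aR b' b → BR a a' aR b b')
                      (λ a' a → irrA a a') injA' image
                      (λ a' a aR → partner a a' aR) f'
  in f , λ a a' aR → related a' a aR

lemma8 : {A A' : Set} (AR : A → A' → Set) {B : A → Set} {B' : A' → Set}
    (BR : (a : A) (a' : A') → AR a a' → B a → B' a' → Set) →
    ((a : A) (a' : A') → IsProp (AR a a')) →
    ((a : A) (a' : A') (aR : AR a a') (b : B a) (b' : B' a') → IsProp (BR a a' aR b b')) →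
    Total AR →
    ((a : A) (a' : A') (aR : AR a a') → Total (BR a a' aR)) →
    OneToOne AR →
    Total (RΠ AR BR)
lemma8 AR BR irrA _ (image , preimage) totalB (injA' , injA) =
    RΠ-leftTotal AR BR irrA injA preimage (λ a a' aR → proj₁ (totalB a a' aR))
  , RΠ-rightTotal AR BR irrA injA' image (λ a a' aR → proj₂ (totalB a a' aR))
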